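{- Let $k\geq 3$ and $n=2k+1$. Let $\sigma:[n]\to[n]$ be the circular shift $\sigma(i)=i+1$ for $1\le i\le n-1$ and $\sigma(n)=1$, and for $A\subset[n]$ write $\sigma(A)=\{\sigma(a):a\in A\}$. Let $L_3=\{1,2,4\}$ and, for $k\geq 4$, $L_k=\{1,2,4\}\cup\{7,9,11,\ldots,2k-1\}$ (that is, $\{1,2,4\}$ together with all odd integers from $7$ to $2k-1$). Let $\mathcal{F}_k=\{\sigma^i(L_k): i=0,1,\ldots,n-1\}\subset 2^{[n]}$. Then $\mathcal{F}_k$ is a regular intersecting family in which every element $x\in[n]$ has degree $k$.
   Context: $[n]=\{1,\ldots,n\}$ and $2^{[n]}$ is the family of all subsets of $[n]$. A family $\mathcal{F}\subset 2^{[n]}$ is intersecting if any two of its members have nonempty intersection. The degree of $x\in[n]$ in $\mathcal{F}$ is the number of members of $\mathcal{F}$ containing $x$; $\mathcal{F}$ is regular if all $x\in[n]$ have the same degree. -}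

module Defs where

open import Data.Nat using (ℕ; zero; suc; _+_; _*_; _≤ᵇ_; _≡ᵇ_)
open import Data.Nat.DivMod using (_%_; m%n<n)
open import Data.Bool using (Bool; true; false; _∨_; _∧_)
open import Data.Fin using (Fin; toℕ; fromℕ<; _≟_)
open import Data.Fin.Subset using (Subset; _∈_; _∩_; Nonempty)
open import Data.Fin.Subset.Properties using (_∈?_)
open import Data.List using (List; map; length; filter; allFin)
open import Data.Bool.ListAction using (any)
import Data.List.Membership.Propositional as LM
open import Data.Vec using (tabulate)
open import Relation.Nullary.Decidable using (⌊_⌋)

-- Convention: the ground set [n] = {1,…,n} is modelled by Fin n,
-- where the element j : Fin n stands for the integer toℕ j + 1.

σ : ∀ {n} → Fin n → Fin n
σ {suc m} j = fromℕ< (m%n<n (suc (toℕ j)) (suc m))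

iter : ∀ {n} → ℕ → (Fin n → Fin n) → Fin n → Fin n
iter zero    f x = x
iter (suc i) f x = f (iter i f x)

image : ∀ {n} → (Fin n → Fin n) → Subset n → Subset n
image {n} f A = tabulate λ y → any (λ a → ⌊ f a ≟ y ⌋ ∧ ⌊ a ∈? A ⌋) (allFin n)

σ^ : ∀ {n} → ℕ → Subset n → Subset n
σ^ zero    A = A
σ^ (suc i) A = image σ (σ^ i A)

inLᵇ : ℕ → ℕ → Bool
inLᵇ k m = (m ≡ᵇ 1) ∨ (m ≡ᵇ 2) ∨ (m ≡ᵇ 4)
         ∨ ((m % 2 ≡ᵇ 1) ∧ (7 ≤ᵇ m) ∧ (suc m ≤ᵇ 2 * k))

L : (k : ℕ) → Subset (2 * k + 1)
L k = tabulate λ j → inLᵇ k (suc (toℕ j))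

F : (k : ℕ) → List (Subset (2 * k + 1))
F k = map (λ i → σ^ (toℕ i) (L k)) (allFin (2 * k + 1))

Intersecting : ∀ {n} → List (Subset n) → Set
Intersecting {n} 𝓕 = ∀ {A B} → A LM.∈ 𝓕
                           → B LM.∈ 𝓕 → Nonempty (A ∩ B)

degree : ∀ {n} → List (Subset n) → Fin n → ℕ
degree 𝓕 x = length (filter (λ A → x ∈? A) 𝓕)

-- F_k is the orbit of L_k under the cyclic group generated by σ, and the three
-- claims are properties of such orbits. Since x ∈ σⁱ(A) iff x − i ∈ A and
-- i ↦ x − i is a bijection of ℤ/n, every point lies in exactly |A| shifts of A.
-- The shifts σᵃ(A) and σᵇ(A) meet iff a − b is a difference of two elements
-- of A, and for A = L_k every residue mod n is such a difference. The shifts of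
-- L_k are pairwise distinct because {1,2} is the only pair of cyclically
-- consecutive elements of L_k, so σᵃ(L_k) = σᵇ(L_k) forces σᵃ(1) = σᵇ(1).
module Submission where

open import Defs
open import Data.Bool using (Bool; true; false; T; _∧_)
open import Data.Bool.Properties using (T-≡; T-∧)
open import Data.Empty using (⊥-elim)
open import Data.Fin using (Fin; zero; suc; toℕ; opposite; inject₁; fromℕ; _≟_)
open import Data.Fin.Permutation using (reverse)
open import Data.Fin.Properties
  using (toℕ-injective; toℕ<n; toℕ-inject₁; toℕ-fromℕ; toℕ-fromℕ<; opposite-prop)
open import Data.Fin.Subset using (Subset; _∈_; _∩_; Nonempty; ∣_∣)
open import Data.Fin.Subset.Properties using (_∈?_; x∈p∩q⁺; ∩-comm)
open import Data.List using (List; map; filter; length; allFin; tabulate)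
open import Data.List.Properties using (map-tabulate)
open import Data.List.Membership.Propositional using (lose) renaming (_∈_ to _∈ₗ_)
open import Data.List.Membership.Propositional.Properties using (∈-allFin; ∈-map⁻)
open import Data.List.Relation.Unary.Any using (Any; satisfied)
open import Data.List.Relation.Unary.Any.Properties using (any⇔)
open import Data.List.Relation.Unary.Unique.Propositional using (Unique)
import Data.List.Relation.Unary.Unique.Propositional.Properties as Unique
open import Data.Nat
  using (ℕ; zero; suc; _+_; _*_; _∸_; _≤_; _<_; _%_; _≡ᵇ_; z≤n; s≤s; compare; less; equal; greater)
open import Data.Nat.DivMod using (_mod_; m%n<n; m<n⇒m%n≡m; [m+n]%n≡m%n; [m+kn]%n≡m%n; %-distribˡ-+; m%n%n≡m%n)
open import Data.Nat.Properties
  using (+-comm; +-assoc; +-suc; +-identityʳ; +-monoʳ-≤; *-monoʳ-≤; *-monoˡ-≤; ≤-refl; ≤-reflexive; ≤-trans;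
         ≤-total; ≤-pred; <⇒≤; <-trans; <-irrefl; n<1+n; m≤m+n; m≤n+m; m∸n≤m; m∸n+n≡m; m+[n∸m]≡n; m+n≮m;
         ≤ᵇ⇒≤; ≤⇒≤ᵇ; +-0-commutativeMonoid)
open import Algebra.Properties.CommutativeMonoid.Sum +-0-commutativeMonoid
  using (sum-syntax; sum-init-last; sum-cong-≗; ∑-permute)
open import Data.Nat.Tactic.RingSolver using (solve-∀)
open import Data.Product using (_×_; _,_; ∃₂; ∃-syntax)
open import Data.Sum using (_⊎_; inj₁; inj₂)
open import Data.Unit using (tt)
open import Data.Vec using () renaming (tabulate to tabulateᵛ; [] to []ᵛ; _∷_ to _∷ᵛ_)
open import Data.Vec.Properties using (lookup∘tabulate; []=⇒lookup; lookup⇒[]=)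
open import Function using (_∘_; _⇔_; mk⇔; Equivalence)
open import Function.Definitions using (Injective)
import Function.Properties.Equivalence as ⇔
open import Relation.Binary.PropositionalEquality using (_≡_; refl; sym; trans; cong; cong₂; subst; module ≡-Reasoning)
open import Relation.Nullary using (does; ¬_)
open import Relation.Nullary.Decidable using (⌊_⌋; does-⇔; dec-true; dec-false; toWitness; fromWitness; T?)
open import Relation.Unary using (Pred; Decidable)

open Equivalence using (to; from)
open ≡-Reasoning

indicator : Bool → ℕ
indicator true  = 1
indicator false = 0

length-filter-tabulate : ∀ {a p} {A : Set a} {P : Pred A p} (P? : Decidable P) {n} (f : Fin n → A) →
                         length (filter P? (tabulate f)) ≡ ∑[ i < n ] indicator (does (P? (f i)))
length-filter-tabulate P? {zero}  f = refl
length-filter-tabulate P? {suc n} f with does (P? (f zero))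
... | true  = cong suc (length-filter-tabulate P? (f ∘ suc))
... | false = length-filter-tabulate P? (f ∘ suc)

∣p∣≡∑ : ∀ {n} (p : Subset n) → ∣ p ∣ ≡ ∑[ i < n ] indicator (does (i ∈? p))
∣p∣≡∑ []ᵛ           = refl
∣p∣≡∑ (true ∷ᵛ p)  = cong suc (∣p∣≡∑ p)
∣p∣≡∑ (false ∷ᵛ p) = ∣p∣≡∑ p

∈-tabulate⇔ : ∀ {n} {f : Fin n → Bool} {x : Fin n} → x ∈ tabulateᵛ f ⇔ T (f x)
∈-tabulate⇔ {f = f} {x} = mk⇔
  (λ x∈ → from T-≡ (trans (sym (lookup∘tabulate f x)) ([]=⇒lookup x∈)))
  (λ fx → lookup⇒[]= x _ (trans (lookup∘tabulate f x) (to T-≡ fx)))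

∑-cong : ∀ {n} {f g : Fin n → ℕ} → (∀ i → f i ≡ g i) → ∑[ i < n ] f i ≡ ∑[ i < n ] g i
∑-cong = sum-cong-≗

∑-toℕ-init-last : ∀ N (h : ℕ → ℕ) → ∑[ i < suc N ] h (toℕ i) ≡ ∑[ i < N ] h (toℕ i) + h N
∑-toℕ-init-last N h = begin
  ∑[ i < suc N ] h (toℕ i)                              ≡⟨ sum-init-last (h ∘ toℕ) ⟩
  ∑[ i < N ] h (toℕ (inject₁ i)) + h (toℕ (fromℕ N))
    ≡⟨ cong₂ _+_ (∑-cong {N} (cong h ∘ toℕ-inject₁)) (cong h (toℕ-fromℕ N)) ⟩
  ∑[ i < N ] h (toℕ i) + h N                            ∎

∑-rotate : ∀ {n} (h : ℕ → ℕ) → (∀ v → h (v + n) ≡ h v) →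
           ∀ c → ∑[ i < n ] h (c + toℕ i) ≡ ∑[ i < n ] h (toℕ i)
∑-rotate         h periodic zero    = refl
∑-rotate {zero}  h periodic (suc c) = refl
∑-rotate {suc m} h periodic (suc c) = begin
  ∑[ i < suc m ] h (suc c + toℕ i)                  ≡⟨ ∑-toℕ-init-last m (λ j → h (suc c + j)) ⟩
  ∑[ i < m ] h (suc c + toℕ i) + h (suc c + m)      ≡⟨ cong₂ _+_ (∑-cong {m} λ i → cong h (sym (+-suc c (toℕ i))))
                                                               (trans (cong h (sym (+-suc c m))) (periodic c)) ⟩
  ∑[ i < m ] h (c + toℕ (suc i)) + h c              ≡⟨ +-comm _ (h c) ⟩
  h c + ∑[ i < m ] h (c + toℕ (suc i))
    ≡⟨ cong (λ v → h v + ∑[ i < m ] h (c + toℕ (suc i))) (+-identityʳ c) ⟨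
  ∑[ i < suc m ] h (c + toℕ i)                      ≡⟨ ∑-rotate h periodic c ⟩
  ∑[ i < suc m ] h (toℕ i)                          ∎

iter-commute : ∀ {n} (f : Fin n → Fin n) i x → iter i f (f x) ≡ f (iter i f x)
iter-commute f zero    x = refl
iter-commute f (suc i) x = cong f (iter-commute f i x)

∈-image⇔ : ∀ {n} {f : Fin n → Fin n} {A : Subset n} {z : Fin n} →
           Injective _≡_ _≡_ f → f z ∈ image f A ⇔ z ∈ A
∈-image⇔ {n} {f} {A} {z} f-injective = ⇔.trans ∈-tabulate⇔ (⇔.trans (⇔.sym any⇔) (mk⇔ any→∈ ∈→any))
  where
  preimage? : Fin n → Bool
  preimage? a = ⌊ f a ≟ f z ⌋ ∧ ⌊ a ∈? A ⌋
  any→∈ : Any (T ∘ preimage?) (allFin n) → z ∈ A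
  any→∈ any-a with satisfied any-a
  ... | a , hit with to (T-∧ {⌊ f a ≟ f z ⌋}) hit
  ...   | fa≡fz , a∈A = subst (_∈ A) (f-injective (toWitness fa≡fz)) (toWitness {a? = a ∈? A} a∈A)
  ∈→any : z ∈ A → Any (T ∘ preimage?) (allFin n)
  ∈→any z∈A = lose (∈-allFin z)
    (from (T-∧ {⌊ f z ≟ f z ⌋}) (fromWitness refl , fromWitness {a? = z ∈? A} z∈A))

module _ {m : ℕ} where
  private
    n : ℕ
    n = suc m

  toℕ-mod : ∀ v → toℕ (v mod n) ≡ v % n
  toℕ-mod v = toℕ-fromℕ< (m%n<n v n)

  mod-cong : ∀ {v w} → v % n ≡ w % n → v mod n ≡ w mod n
  mod-cong {v} {w} eq = toℕ-injective (trans (toℕ-mod v) (trans eq (sym (toℕ-mod w))))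

  toℕ-mod-< : ∀ {v} → v < n → toℕ (v mod n) ≡ v
  toℕ-mod-< {v} v<n = trans (toℕ-mod v) (m<n⇒m%n≡m v<n)

  toℕ-mod-id : (x : Fin n) → toℕ x mod n ≡ x
  toℕ-mod-id x = toℕ-injective (toℕ-mod-< (toℕ<n x))

  toℕ+n-mod : (x : Fin n) → (toℕ x + n) mod n ≡ x
  toℕ+n-mod x = trans (mod-cong {toℕ x + n} {toℕ x} ([m+n]%n≡m%n (toℕ x) n)) (toℕ-mod-id x)

  %-cong-+ʳ : ∀ {v w} b → v % n ≡ w % n → (v + b) % n ≡ (w + b) % n
  %-cong-+ʳ {v} {w} b eq = begin
    (v + b) % n          ≡⟨ %-distribˡ-+ v b n ⟩
    (v % n + b % n) % n  ≡⟨ cong (λ r → (r + b % n) % n) eq ⟩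
    (w % n + b % n) % n  ≡⟨ %-distribˡ-+ w b n ⟨
    (w + b) % n          ∎

  σ-mod : ∀ v → σ (v mod n) ≡ suc v mod n
  σ-mod v = mod-cong {suc (toℕ (v mod n))} {suc v} (begin
    suc (toℕ (v mod n)) % n  ≡⟨ cong (λ r → suc r % n) (toℕ-mod v) ⟩
    suc (v % n) % n          ≡⟨ cong (_% n) (+-comm 1 (v % n)) ⟩
    (v % n + 1) % n          ≡⟨ %-cong-+ʳ {v % n} {v} 1 (m%n%n≡m%n v n) ⟩
    (v + 1) % n              ≡⟨ cong (_% n) (+-comm v 1) ⟩
    suc v % n                ∎)

  iter-σ-mod : ∀ i v → iter i σ (v mod n) ≡ (v + i) mod n
  iter-σ-mod zero    v = cong (_mod n) (sym (+-identityʳ v))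
  iter-σ-mod (suc i) v = begin
    σ (iter i σ (v mod n))  ≡⟨ cong σ (iter-σ-mod i v) ⟩
    σ ((v + i) mod n)       ≡⟨ σ-mod (v + i) ⟩
    suc (v + i) mod n       ≡⟨ cong (_mod n) (+-suc v i) ⟨
    (v + suc i) mod n       ∎

  σ-injective : Injective _≡_ _≡_ (σ {n})
  σ-injective {x} {y} σx≡σy = begin
    x                  ≡⟨ period x ⟨
    σ (iter m σ x)     ≡⟨ iter-commute σ m x ⟨
    iter m σ (σ x)     ≡⟨ cong (iter m σ) σx≡σy ⟩
    iter m σ (σ y)     ≡⟨ iter-commute σ m y ⟩
    σ (iter m σ y)     ≡⟨ period y ⟩
    y                  ∎
    where
    period : ∀ z → iter n σ z ≡ z
    period z = trans (cong (iter n σ) (sym (toℕ-mod-id z))) (trans (iter-σ-mod n (toℕ z)) (toℕ+n-mod z))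

  ∈-σ^⇔ : ∀ i {A : Subset n} {z} → iter i σ z ∈ σ^ i A ⇔ z ∈ A
  ∈-σ^⇔ zero    = ⇔.refl
  ∈-σ^⇔ (suc i) = ⇔.trans (∈-image⇔ σ-injective) (∈-σ^⇔ i)

  mod-∈-σ^⇔ : ∀ i v {A : Subset n} → (v + i) mod n ∈ σ^ i A ⇔ v mod n ∈ A
  mod-∈-σ^⇔ i v {A} = subst (λ y → y ∈ σ^ i A ⇔ v mod n ∈ A) (iter-σ-mod i v) (∈-σ^⇔ i)

  shift : Subset n → Fin n → Subset n
  shift A i = σ^ (toℕ i) A

  orbit : Subset n → List (Subset n)
  orbit A = map (shift A) (allFin n)

  degree-orbit : (A : Subset n) (x : Fin n) → degree (orbit A) x ≡ ∣ A ∣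
  degree-orbit A x = begin
    length (filter (x ∈?_) (map (shift A) (allFin n)))
      ≡⟨ cong (length ∘ filter (x ∈?_)) (map-tabulate (λ i → i) (shift A)) ⟩
    length (filter (x ∈?_) (tabulate (shift A)))           ≡⟨ length-filter-tabulate (x ∈?_) (shift A) ⟩
    ∑[ i < n ] indicator (does (x ∈? shift A i))
      ≡⟨ ∑-permute (λ i → indicator (does (x ∈? shift A i))) reverse ⟩
    ∑[ i < n ] indicator (does (x ∈? shift A (opposite i)))
      ≡⟨ ∑-cong (λ i → cong indicator (does-⇔ (∈-reversed-shift i) (x ∈? shift A (opposite i)) (_ ∈? A))) ⟩
    ∑[ i < n ] h (suc (toℕ x) + toℕ i)                     ≡⟨ ∑-rotate h periodic (suc (toℕ x)) ⟩
    ∑[ i < n ] h (toℕ i)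
      ≡⟨ ∑-cong (λ i → cong (λ y → indicator (does (y ∈? A))) (toℕ-mod-id i)) ⟩
    ∑[ i < n ] indicator (does (i ∈? A))                   ≡⟨ ∣p∣≡∑ A ⟨
    ∣ A ∣                                                  ∎
    where
    h : ℕ → ℕ
    h v = indicator (does (v mod n ∈? A))
    periodic : ∀ v → h (v + n) ≡ h v
    periodic v = cong (λ y → indicator (does (y ∈? A))) (mod-cong {v + n} {v} ([m+n]%n≡m%n v n))
    ∈-reversed-shift : ∀ i → x ∈ shift A (opposite i) ⇔ (suc (toℕ x) + toℕ i) mod n ∈ A
    ∈-reversed-shift i = subst (λ j → x ∈ σ^ j A ⇔ v mod n ∈ A) (sym (opposite-prop i))
      (subst (λ y → y ∈ σ^ (m ∸ toℕ i) A ⇔ v mod n ∈ A) x≡ (mod-∈-σ^⇔ (m ∸ toℕ i) v))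
      where
      v : ℕ
      v = suc (toℕ x) + toℕ i
      i≤m : toℕ i ≤ m
      i≤m = ≤-pred (toℕ<n i)
      x≡ : (v + (m ∸ toℕ i)) mod n ≡ x
      x≡ = begin
        (suc (toℕ x) + toℕ i + (m ∸ toℕ i)) mod n  ≡⟨ cong (λ r → suc r mod n) (+-assoc (toℕ x) (toℕ i) _) ⟩
        suc (toℕ x + (toℕ i + (m ∸ toℕ i))) mod n  ≡⟨ cong (λ r → suc (toℕ x + r) mod n) (m+[n∸m]≡n i≤m) ⟩
        suc (toℕ x + m) mod n                       ≡⟨ cong (_mod n) (+-suc (toℕ x) m) ⟨
        (toℕ x + n) mod n                           ≡⟨ toℕ+n-mod x ⟩
        x                                           ∎

  module _ {A : Subset n} (0∈A : zero ∈ A) (1∈A : σ zero ∈ A)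
           (consecutive⇒0 : ∀ z → z ∈ A → σ z ∈ A → z ≡ zero) where

    shift-injective : Injective _≡_ _≡_ (shift A)
    shift-injective {a} {b} shifts≡ = begin
      a                     ≡⟨ toℕ-mod-id a ⟨
      (0 + toℕ a) mod n     ≡⟨ realign 0 ⟨
      (w + toℕ b) mod n     ≡⟨ mod-cong {w + toℕ b} {0 + toℕ b} (%-cong-+ʳ {w} {0} (toℕ b) w%n≡0) ⟩
      (0 + toℕ b) mod n     ≡⟨ toℕ-mod-id b ⟩
      b                     ∎
      where
      -- w ≡ a − b (mod n): σᵇ carries the consecutive pair {w, w + 1} of A onto the pair {a, a + 1} of σᵃ(A).
      w : ℕ
      w = toℕ a + (n ∸ toℕ b)
      realign : ∀ v → (v + w + toℕ b) mod n ≡ (v + toℕ a) mod n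
      realign v = mod-cong {v + w + toℕ b} {v + toℕ a} (begin
        (v + w + toℕ b) % n          ≡⟨ cong (_% n) (+-assoc v w (toℕ b)) ⟩
        (v + (w + toℕ b)) % n        ≡⟨ cong (λ r → (v + r) % n) (+-assoc (toℕ a) (n ∸ toℕ b) (toℕ b)) ⟩
        (v + (toℕ a + (n ∸ toℕ b + toℕ b))) % n ≡⟨ cong (λ r → (v + (toℕ a + r)) % n) (m∸n+n≡m (<⇒≤ (toℕ<n b))) ⟩
        (v + (toℕ a + n)) % n        ≡⟨ cong (_% n) (+-assoc v (toℕ a) n) ⟨
        (v + toℕ a + n) % n          ≡⟨ [m+n]%n≡m%n (v + toℕ a) n ⟩
        (v + toℕ a) % n              ∎)
      pull-back : ∀ v → v mod n ∈ A → (v + w) mod n ∈ A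
      pull-back v v∈A = to (mod-∈-σ^⇔ (toℕ b) (v + w))
        (subst (_∈ σ^ (toℕ b) A) (sym (realign v))
          (subst ((v + toℕ a) mod n ∈_) shifts≡ (from (mod-∈-σ^⇔ (toℕ a) v) v∈A)))
      w%n≡0 : w % n ≡ 0
      w%n≡0 = trans (sym (toℕ-mod w)) (cong toℕ (consecutive⇒0 (w mod n) (pull-back 0 0∈A) σw∈A))
        where
        σw∈A : σ (w mod n) ∈ A
        σw∈A = subst (_∈ A) (sym (σ-mod w)) (pull-back 1 1∈A)

    orbit-unique : Unique (orbit A)
    orbit-unique = Unique.map⁺ shift-injective (Unique.allFin⁺ n)

  IsDifferenceCover : Subset n → Set
  IsDifferenceCover A = ∀ d → d < n → ∃₂ λ p q → p mod n ∈ A × q mod n ∈ A × (p + d) % n ≡ q % n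

  module _ {A : Subset n} (cover : IsDifferenceCover A) where

    shifts-meet : ∀ {a b : Fin n} → toℕ b ≤ toℕ a → Nonempty (shift A a ∩ shift A b)
    shifts-meet {a} {b} b≤a with cover (toℕ a ∸ toℕ b) (≤-trans (s≤s (m∸n≤m (toℕ a) (toℕ b))) (toℕ<n a))
    ... | p , q , p∈A , q∈A , p+d≡q = (p + toℕ a) mod n , x∈p∩q⁺ (in-a , in-b)
      where
      in-a : (p + toℕ a) mod n ∈ σ^ (toℕ a) A
      in-a = from (mod-∈-σ^⇔ (toℕ a) p) p∈A
      same : (q + toℕ b) mod n ≡ (p + toℕ a) mod n
      same = mod-cong {q + toℕ b} {p + toℕ a} (begin
        (q + toℕ b) % n                       ≡⟨ %-cong-+ʳ {p + (toℕ a ∸ toℕ b)} {q} (toℕ b) p+d≡q ⟨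
        (p + (toℕ a ∸ toℕ b) + toℕ b) % n     ≡⟨ cong (_% n) (+-assoc p _ (toℕ b)) ⟩
        (p + (toℕ a ∸ toℕ b + toℕ b)) % n     ≡⟨ cong (λ r → (p + r) % n) (m∸n+n≡m b≤a) ⟩
        (p + toℕ a) % n                       ∎)
      in-b : (p + toℕ a) mod n ∈ σ^ (toℕ b) A
      in-b = subst (_∈ σ^ (toℕ b) A) same (from (mod-∈-σ^⇔ (toℕ b) q) q∈A)

    orbit-intersecting : Intersecting (orbit A)
    orbit-intersecting B∈ C∈ = meet (∈-map⁻ (shift A) B∈) (∈-map⁻ (shift A) C∈)
      where
      meet : ∀ {B C} → ∃[ a ] a ∈ₗ allFin n × B ≡ shift A a →
                       ∃[ b ] b ∈ₗ allFin n × C ≡ shift A b → Nonempty (B ∩ C)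
      meet (a , _ , refl) (b , _ , refl) with ≤-total (toℕ b) (toℕ a)
      ... | inj₁ b≤a = shifts-meet {a} {b} b≤a
      ... | inj₂ a≤b = subst Nonempty (∩-comm _ _) (shifts-meet {b} {a} a≤b)

even⊎odd : ∀ x → ∃[ e ] (x ≡ e * 2 ⊎ x ≡ suc (e * 2))
even⊎odd zero          = 0 , inj₁ refl
even⊎odd (suc zero)    = 0 , inj₂ refl
even⊎odd (suc (suc x)) with even⊎odd x
... | e , inj₁ refl = suc e , inj₁ refl
... | e , inj₂ refl = suc e , inj₂ refl

inLᵇ⇒≤2k : ∀ {k} m → 2 ≤ k → T (inLᵇ k m) → m ≤ 2 * k
inLᵇ⇒≤2k 1 2≤k _ = ≤-trans (s≤s z≤n) (*-monoʳ-≤ 2 2≤k)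
inLᵇ⇒≤2k 2 2≤k _ = ≤-trans (s≤s (s≤s z≤n)) (*-monoʳ-≤ 2 2≤k)
inLᵇ⇒≤2k 4 2≤k _ = *-monoʳ-≤ 2 2≤k
inLᵇ⇒≤2k {k} (suc (suc (suc (suc (suc (suc (suc x))))))) _ m∈L with (7 + x) % 2 ≡ᵇ 1
... | true  = <⇒≤ (≤ᵇ⇒≤ (8 + x) (2 * k) m∈L)
inLᵇ⇒≤2k 0 _ ()
inLᵇ⇒≤2k 3 _ ()
inLᵇ⇒≤2k 5 _ ()
inLᵇ⇒≤2k 6 _ ()

inLᵇ-even : ∀ k e → inLᵇ k (8 + e * 2) ≡ false
inLᵇ-even k e with (8 + e * 2) % 2 | [m+kn]%n≡m%n 8 e 2
... | _ | refl = refl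

inLᵇ-odd : ∀ {k} e → 8 + e * 2 ≤ 2 * k → T (inLᵇ k (7 + e * 2))
inLᵇ-odd {k} e in-range with (7 + e * 2) % 2 | [m+kn]%n≡m%n 7 e 2
... | _ | refl = ≤⇒≤ᵇ in-range

inLᵇ-consecutive⇒0 : ∀ k v → T (inLᵇ k (suc v)) → T (inLᵇ k (2 + v)) → v ≡ 0
inLᵇ-consecutive⇒0 k 0 _ _ = refl
inLᵇ-consecutive⇒0 k (suc (suc (suc (suc (suc (suc x)))))) first second with even⊎odd x
... | e , inj₁ refl = ⊥-elim (subst T (inLᵇ-even k e) second)
... | e , inj₂ refl = ⊥-elim (subst T (inLᵇ-even k e) first)
inLᵇ-consecutive⇒0 k 1 _ ()
inLᵇ-consecutive⇒0 k 2 () _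
inLᵇ-consecutive⇒0 k 3 _ ()
inLᵇ-consecutive⇒0 k 4 () _
inLᵇ-consecutive⇒0 k 5 () _

2*[3+t]≡6+t*2 : ∀ t → 2 * (3 + t) ≡ 6 + t * 2
2*[3+t]≡6+t*2 = solve-∀

2*[3+t]+1≡7+t*2 : ∀ t → 2 * (3 + t) + 1 ≡ 7 + t * 2
2*[3+t]+1≡7+t*2 = solve-∀

∈L⇔ : ∀ {k} {j : Fin (2 * k + 1)} → j ∈ L k ⇔ T (inLᵇ k (suc (toℕ j)))
∈L⇔ = ∈-tabulate⇔

inLᵇ-odd-< : ∀ {t e} → e < t → T (inLᵇ (3 + t) (7 + e * 2))
inLᵇ-odd-< {t} {e} e<t =
  inLᵇ-odd {3 + t} e (subst (8 + e * 2 ≤_) (sym (2*[3+t]≡6+t*2 t)) (+-monoʳ-≤ 6 (*-monoˡ-≤ 2 e<t)))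

∑-inL-prefix : ∀ t e → e ≤ t → ∑[ i < 6 + e * 2 ] indicator (inLᵇ (3 + t) (suc (toℕ i))) ≡ 3 + e
∑-inL-prefix t zero    _   = refl
∑-inL-prefix t (suc e) e<t = begin
  ∑[ i < 8 + e * 2 ] g (toℕ i)                      ≡⟨ ∑-toℕ-init-last (7 + e * 2) g ⟩
  ∑[ i < 7 + e * 2 ] g (toℕ i) + g (7 + e * 2)
    ≡⟨ cong₂ _+_ (∑-toℕ-init-last (6 + e * 2) g) (cong indicator (inLᵇ-even (3 + t) e)) ⟩
  ∑[ i < 6 + e * 2 ] g (toℕ i) + g (6 + e * 2) + 0
    ≡⟨ cong₂ (λ a b → a + b + 0) (∑-inL-prefix t e (<⇒≤ e<t))
             (cong indicator (dec-true (T? _) (inLᵇ-odd-< e<t))) ⟩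
  3 + e + 1 + 0                                     ≡⟨ trans (+-identityʳ _) (+-comm (3 + e) 1) ⟩
  3 + suc e                                         ∎
  where
  g : ℕ → ℕ
  g v = indicator (inLᵇ (3 + t) (suc v))

∣L∣ : ∀ t → ∣ L (3 + t) ∣ ≡ 3 + t
∣L∣ t = begin
  ∣ L k ∣                                          ≡⟨ ∣p∣≡∑ (L k) ⟩
  ∑[ i < 2 * k + 1 ] indicator (does (i ∈? L k))
    ≡⟨ ∑-cong {2 * k + 1} (λ i → cong indicator (does-⇔ (∈L⇔ {k}) (i ∈? L k) (T? (inLᵇ k (suc (toℕ i)))))) ⟩
  ∑[ i < 2 * k + 1 ] g (toℕ i)                     ≡⟨ cong (λ N → ∑[ i < N ] g (toℕ i)) (2*[3+t]+1≡7+t*2 t) ⟩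
  ∑[ i < 7 + t * 2 ] g (toℕ i)                     ≡⟨ ∑-toℕ-init-last (6 + t * 2) g ⟩
  ∑[ i < 6 + t * 2 ] g (toℕ i) + g (6 + t * 2)
    ≡⟨ cong₂ _+_ (∑-inL-prefix t t ≤-refl) (cong indicator (dec-false (T? _) top∉L)) ⟩
  3 + t + 0                                        ≡⟨ +-identityʳ _ ⟩
  3 + t                                            ∎
  where
  k : ℕ
  k = 3 + t
  g : ℕ → ℕ
  g v = indicator (inLᵇ k (suc v))
  top∉L : ¬ T (inLᵇ k (7 + t * 2))
  top∉L top∈L =
    <-irrefl refl (subst (7 + t * 2 ≤_) (2*[3+t]≡6+t*2 t) (inLᵇ⇒≤2k {k} (7 + t * 2) (s≤s (s≤s z≤n)) top∈L))

inLᵇ⇒<n : ∀ t {v} → T (inLᵇ (3 + t) v) → v < 2 * (3 + t) + 1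
inLᵇ⇒<n t {v} v∈L =
  ≤-trans (s≤s (inLᵇ⇒≤2k {3 + t} v (s≤s (s≤s z≤n)) v∈L)) (≤-reflexive (+-comm 1 (2 * (3 + t))))

mod-∈L : ∀ t {v} → T (inLᵇ (3 + t) (suc v)) → v mod (2 * (3 + t) + 1) ∈ L (3 + t)
mod-∈L t {v} v∈L =
  from (∈L⇔ {3 + t} {v mod _}) (subst (λ w → T (inLᵇ (3 + t) (suc w))) (sym (toℕ-mod-< {v = v} v<n)) v∈L)
  where
  v<n : v < 2 * (3 + t) + 1
  v<n = <-trans (n<1+n v) (inLᵇ⇒<n t v∈L)

L-consecutive⇒0 : ∀ t (z : Fin (2 * (3 + t) + 1)) → z ∈ L (3 + t) → σ z ∈ L (3 + t) → z ≡ zero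
L-consecutive⇒0 t z z∈L σz∈L = toℕ-injective (inLᵇ-consecutive⇒0 (3 + t) (toℕ z) first second)
  where
  first : T (inLᵇ (3 + t) (suc (toℕ z)))
  first = to (∈L⇔ {3 + t}) z∈L
  second : T (inLᵇ (3 + t) (2 + toℕ z))
  second = subst (λ w → T (inLᵇ (3 + t) (suc w)))
                 (toℕ-mod-< {v = suc (toℕ z)} (inLᵇ⇒<n t first)) (to (∈L⇔ {3 + t} {σ z}) σz∈L)

-- p and q stand for the elements p + 1 and q + 1 of L_k.
DifferenceInL : ℕ → ℕ → Set
DifferenceInL t d = ∃₂ λ p q → T (inLᵇ (3 + t) (suc p)) × T (inLᵇ (3 + t) (suc q))
                             × (q ≡ p + d ⊎ q + (7 + t * 2) ≡ p + d)

even-difference : ∀ t e → 4 + e * 2 < 7 + t * 2 → DifferenceInL t (4 + e * 2)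
even-difference t e d<n with compare e t
... | less .e o          = 6 + o * 2 , 1 , inLᵇ-odd-< (s≤s (m≤n+m o e)) , tt , inj₂ (wrap e o)
  where
  wrap : ∀ e o → 1 + (7 + suc (e + o) * 2) ≡ 6 + o * 2 + (4 + e * 2)
  wrap = solve-∀
... | equal .e           = 3 , 0 , tt , tt , inj₂ refl
... | greater .t zero    = 1 , 0 , tt , tt , inj₂ (cong (λ r → 7 + r * 2) (sym (+-identityʳ t)))
... | greater .t (suc o) = ⊥-elim (m+n≮m (7 + t * 2) (1 + o * 2) (subst (_< 7 + t * 2) (beyond t o) d<n))
  where
  beyond : ∀ t o → 4 + suc (t + suc o) * 2 ≡ 7 + t * 2 + (1 + o * 2)
  beyond = solve-∀

odd-difference : ∀ t e → 5 + e * 2 < 7 + t * 2 → DifferenceInL t (5 + e * 2)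
odd-difference t e d<n with compare e t
... | less .e o     = 1 , 6 + e * 2 , tt , inLᵇ-odd-< (s≤s (m≤m+n e o)) , inj₁ refl
... | equal .e      = 3 , 1 , tt , tt , inj₂ refl
... | greater .t o  = ⊥-elim (m+n≮m (7 + t * 2) (o * 2) (subst (_< 7 + t * 2) (beyond t o) d<n))
  where
  beyond : ∀ t o → 5 + suc (t + o) * 2 ≡ 7 + t * 2 + o * 2
  beyond = solve-∀

differences : ∀ t d → d < 7 + t * 2 → DifferenceInL t d
differences t 0 _ = 0 , 0 , tt , tt , inj₁ refl
differences t 1 _ = 0 , 1 , tt , tt , inj₁ refl
differences t 2 _ = 1 , 3 , tt , tt , inj₁ refl
differences t 3 _ = 0 , 3 , tt , tt , inj₁ refl
differences t (suc (suc (suc (suc x)))) d<n with even⊎odd x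
... | e , inj₁ refl = even-difference t e d<n
... | e , inj₂ refl = odd-difference t e d<n

L-difference-cover : ∀ t → IsDifferenceCover (L (3 + t))
L-difference-cover t d d<n with differences t d (subst (d <_) (2*[3+t]+1≡7+t*2 t) d<n)
... | p , q , p∈L , q∈L , q≈p+d = p , q , mod-∈L t {p} p∈L , mod-∈L t {q} q∈L , residue q≈p+d
  where
  n : ℕ
  n = 2 * (3 + t) + 1
  residue : q ≡ p + d ⊎ q + (7 + t * 2) ≡ p + d → (p + d) % n ≡ q % n
  residue (inj₁ q≡p+d)   = cong (_% n) (sym q≡p+d)
  residue (inj₂ q+n≡p+d) = begin
    (p + d) % n            ≡⟨ cong (_% n) q+n≡p+d ⟨
    (q + (7 + t * 2)) % n  ≡⟨ cong (λ r → (q + r) % n) (2*[3+t]+1≡7+t*2 t) ⟨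
    (q + n) % n            ≡⟨ [m+n]%n≡m%n q n ⟩
    q % n                  ∎

lemma2p1 : (k : ℕ) → 3 ≤ k →
    Unique (F k) × Intersecting (F k) × ((x : Fin (2 * k + 1)) → degree (F k) x ≡ k)
lemma2p1 (suc (suc (suc t))) (s≤s (s≤s (s≤s z≤n))) =
    orbit-unique (from (∈L⇔ {3 + t}) tt) (from (∈L⇔ {3 + t}) tt) (L-consecutive⇒0 t)
  , orbit-intersecting (L-difference-cover t)
  , λ x → trans (degree-orbit (L (3 + t)) x) (∣L∣ t)
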